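{- Let $k$ be a nonnegative integer, let $G=(V,E)$ be a connected graph and let $P_1,\ldots,P_r$ be a partition of $V$. Then \[\gamma_{P,k}(G)\leq \sum_{i=1}^r \gamma_{P,k}(\widehat{P_i}).\]
   Context: Graphs are finite, simple and undirected; $N(v)$ is the open neighborhood and $N[S]=\bigcup_{v\in S}(N(v)\cup\{v\})$. For $X\subseteq V$, $\widehat X$ is the graph obtained from the induced subgraph $G[X]$ by attaching to each vertex $x\in X$ as many new pendent vertices as $x$ has neighbors in $G-X$. For a graph $G=(V,E)$, nonnegative integer $k$ and $S\subseteq V$, define $\mathscr P^0_{G,k}(S)=N[S]$ and $\mathscr P^{i+1}_{G,k}(S)=\mathscr P^i_{G,k}(S)\cup\bigcup\{N(v): v\in \mathscr P^i_{G,k}(S),\ 1\le |N(v)\setminus \mathscr P^i_{G,k}(S)|\le k\}$. $S$ is a $k$-power dominating set of $G$ if $\mathscr P^\ell_{G,k}(S)=V$ for some $\ell$; $\gamma_{P,k}(G)$ is the minimum size of such a set. -}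

module Defs where

open import Data.Bool using (Bool; true; false; _∧_; _∨_; not; T)
open import Data.Nat using (ℕ; zero; suc; _≤_; _≤ᵇ_)
open import Data.Fin using (Fin)
open import Data.Fin.Properties using () renaming (_≟_ to _≟ᶠ_)
open import Data.List using (List; []; _∷_; map; filter; length; concatMap; allFin; _++_; tabulate)
open import Data.Bool.ListAction using (any)
open import Data.Nat.ListAction using (sum)
open import Data.List.Membership.Propositional using (_∈_)
open import Data.Product using (_×_; _,_; ∃)
open import Data.Sum using (_⊎_; inj₁; inj₂)
open import Relation.Nullary.Decidable using (⌊_⌋)
open import Relation.Binary.PropositionalEquality using (_≡_)

-- A finite graph presented by a carrier type, an explicit list of its
-- vertices (the vertex set is exactly the listed elements) and a Boolean
-- adjacency relation (only its values on listed vertices matter).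
record FinGraph : Set₁ where
  field
    V     : Set
    verts : List V
    adj   : V → V → Bool
open FinGraph public

Subset : FinGraph → Set
Subset G = V G → Bool

count : {A : Set} → (A → Bool) → List A → ℕ
count p []       = 0
count p (x ∷ xs) with p x
... | true  = suc (count p xs)
... | false = count p xs

size : (G : FinGraph) → Subset G → ℕ
size G S = count S (verts G)

closedNbhd : (G : FinGraph) → Subset G → Subset G
closedNbhd G S w = S w ∨ any (λ u → S u ∧ adj G u w) (verts G)

outside : (G : FinGraph) → Subset G → V G → ℕ
outside G P v = count (λ u → adj G v u ∧ not (P u)) (verts G)

pstep : (G : FinGraph) (k : ℕ) → Subset G → Subset G
pstep G k P w =
  P w ∨ any (λ v → P v ∧ adj G v w ∧ (1 ≤ᵇ outside G P v) ∧ (outside G P v ≤ᵇ k)) (verts G)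

pdIter : (G : FinGraph) (k : ℕ) → Subset G → ℕ → Subset G
pdIter G k S zero    = closedNbhd G S
pdIter G k S (suc i) = pstep G k (pdIter G k S i)

IsKPowerDom : (G : FinGraph) (k : ℕ) → Subset G → Set
IsKPowerDom G k S = ∃ λ ℓ → ∀ v → v ∈ verts G → pdIter G k S ℓ v ≡ true

IsPowerDomNumber : (G : FinGraph) (k : ℕ) → ℕ → Set
IsPowerDomNumber G k m =
  (∃ λ S → IsKPowerDom G k S × size G S ≡ m) ×
  (∀ S → IsKPowerDom G k S → m ≤ size G S)

_==_ : ∀ {n} → Fin n → Fin n → Bool
x == y = ⌊ x ≟ᶠ y ⌋

toGraph : (n : ℕ) → (Fin n → Fin n → Bool) → FinGraph
toGraph n a = record { V = Fin n ; verts = allFin n ; adj = a }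

Symmetric : ∀ {n} → (Fin n → Fin n → Bool) → Set
Symmetric a = ∀ u v → a u v ≡ a v u

Irreflexive : ∀ {n} → (Fin n → Fin n → Bool) → Set
Irreflexive a = ∀ v → a v v ≡ false

data Reach {n : ℕ} (a : Fin n → Fin n → Bool) : Fin n → Fin n → Set where
  here  : ∀ {u} → Reach a u u
  there : ∀ {u w v} → a u w ≡ true → Reach a w v → Reach a u v

Connected : ∀ {n} → (Fin n → Fin n → Bool) → Set
Connected a = ∀ u v → Reach a u v

allPairs : (n : ℕ) → List (Fin n × Fin n)
allPairs n = concatMap (λ x → map (λ y → (x , y)) (allFin n)) (allFin n)

-- X̂ : G[X] plus, for each x ∈ X and each neighbour y ∉ X of x, a new
-- pendent vertex inj₂ (x , y) attached to x.
hatAdj : ∀ {n} → (Fin n → Fin n → Bool) → (Fin n ⊎ (Fin n × Fin n)) → (Fin n ⊎ (Fin n × Fin n)) → Bool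
hatAdj a (inj₁ x) (inj₁ y)       = a x y
hatAdj a (inj₁ x) (inj₂ (x' , _)) = x == x'
hatAdj a (inj₂ (x' , _)) (inj₁ x) = x' == x
hatAdj a (inj₂ _) (inj₂ _)       = false

hat : (n : ℕ) → (Fin n → Fin n → Bool) → (Fin n → Bool) → FinGraph
hat n a X = record
  { V     = Fin n ⊎ (Fin n × Fin n)
  ; verts = map inj₁ (filter (λ x → T? (X x)) (allFin n))
            ++ map inj₂ (filter (λ p → T? (pend p)) (allPairs n))
  ; adj   = hatAdj a
  }
  where
  open import Data.Bool.Properties using (T?)
  pend : Fin n × Fin n → Bool
  pend (x , y) = X x ∧ not (X y) ∧ a x y

sumFin : (r : ℕ) → (Fin r → ℕ) → ℕ
sumFin r f = sum (tabulate f)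

-- Take optimal k-power dominating sets S_i of the graphs P̂_i and merge them
-- into one set S of G: a vertex x ∈ P_i enters S when S_i contains x or one
-- of the pendent vertices attached to x. Each S_i contributes at most |S_i|
-- vertices, so |S| ≤ Σ |S_i|. Monitoring in P̂_i is simulated in G: by
-- induction on the propagation step, every vertex observed in P̂_i is
-- eventually observed in G from S, a pendent vertex (x , y) standing for its
-- outside neighbour y. The crucial point is a forcing step of a vertex x of
-- P̂_i: once every neighbour of x that is observed in P̂_i is observed in G,
-- the unobserved G-neighbours of x inject into the unobserved P̂_i-neighbours
-- of x, so x can force in G as well.
module Submission where

open import Defs
open import Data.Bool using (Bool; true; false; _∧_; _∨_; not; if_then_else_)
open import Data.Bool.ListAction using (any)
open import Data.Bool.Properties using (T?; T-≡; ∨-zeroʳ)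
open import Data.Empty using (⊥-elim)
open import Data.Fin using (Fin)
open import Data.Fin.Properties using () renaming (_≟_ to _≟ᶠ_)
open import Data.List using (List; []; _∷_; map; filter; concatMap; allFin; _++_)
open import Data.List.Membership.Propositional using (_∈_)
open import Data.List.Membership.Propositional.Properties
open import Data.List.Properties using (map-tabulate; map-cong)
open import Data.List.Relation.Unary.Any using (here; there)
import Data.List.Relation.Unary.Any as Any
open import Data.Nat using (ℕ; zero; suc; _+_; _⊔_; _≤_; _≤ᵇ_; _≤′_; ≤′-refl; ≤′-step; z≤n; s≤s)
open import Data.Nat.ListAction using (sum)
open import Data.Nat.Properties
open import Data.Product using (_×_; _,_; proj₁; proj₂; ∃)
open import Data.Sum using (_⊎_; inj₁; inj₂)
open import Function.Bundles using (Equivalence)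
open import Relation.Nullary using (yes; no)
open import Relation.Nullary.Decidable using (dec-true; isYes≗does; toWitness)
open import Relation.Binary.PropositionalEquality

open Equivalence using (to; from)
open import Algebra.Properties.CommutativeSemigroup +-commutativeSemigroup using (interchange)

ind : Bool → ℕ
ind true  = 1
ind false = 0

∨-true⁻ : ∀ b c → b ∨ c ≡ true → b ≡ true ⊎ c ≡ true
∨-true⁻ true  c e = inj₁ refl
∨-true⁻ false c e = inj₂ e

∨-trueˡ : ∀ {b c} → b ≡ true → b ∨ c ≡ true
∨-trueˡ refl = refl

∨-trueʳ : ∀ b {c} → c ≡ true → b ∨ c ≡ true
∨-trueʳ b refl = ∨-zeroʳ b

ind-∨≤ : ∀ b c {m} → (c ≡ true → 1 ≤ m) → ind (b ∨ c) ≤ ind b + m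
ind-∨≤ true  c     h = s≤s z≤n
ind-∨≤ false true  h = h refl
ind-∨≤ false false h = z≤n

∧-true⁻ : ∀ b c → b ∧ c ≡ true → b ≡ true × c ≡ true
∧-true⁻ true c e = refl , e

∧-not-antitone : ∀ b c d → (b ≡ true → d ≡ true → c ≡ true) → b ∧ not c ≡ true → b ∧ not d ≡ true
∧-not-antitone true  false false h e = refl
∧-not-antitone true  false true  h e with h refl refl
... | ()
∧-not-antitone true  true  d     h ()
∧-not-antitone false c     d     h ()

==⇒≡ : ∀ {n} {x y : Fin n} → x == y ≡ true → x ≡ y
==⇒≡ e = toWitness (from T-≡ e)

==-refl : ∀ {n} (x : Fin n) → x == x ≡ true
==-refl x = trans (isYes≗does (x ≟ᶠ x)) (dec-true (x ≟ᶠ x) refl)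

private variable
  A B : Set

sum-map-mono : ∀ (f g : A → ℕ) xs → (∀ x → f x ≤ g x) → sum (map f xs) ≤ sum (map g xs)
sum-map-mono f g []       h = z≤n
sum-map-mono f g (x ∷ xs) h = +-mono-≤ (h x) (sum-map-mono f g xs h)

sum-map-+ : ∀ (f g : A → ℕ) xs →
  sum (map (λ x → f x + g x) xs) ≡ sum (map f xs) + sum (map g xs)
sum-map-+ f g []       = refl
sum-map-+ f g (x ∷ xs) =
  trans (cong (f x + g x +_) (sum-map-+ f g xs))
        (interchange (f x) (g x) (sum (map f xs)) (sum (map g xs)))

sum-map-∈ : ∀ (f : A → ℕ) {x} xs → x ∈ xs → f x ≤ sum (map f xs)
sum-map-∈ f (y ∷ xs) (here refl) = m≤m+n (f y) _
sum-map-∈ f (y ∷ xs) (there x∈)  = ≤-trans (sum-map-∈ f xs x∈) (m≤n+m _ (f y))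

sum-map-swap : ∀ (f : A → B → ℕ) xs ys →
  sum (map (λ x → sum (map (f x) ys)) xs) ≡ sum (map (λ y → sum (map (λ x → f x y) xs)) ys)
sum-map-swap f []       ys = sym (sum-map-zero ys)
  where
  sum-map-zero : ∀ (ys : List B) → sum (map (λ _ → 0) ys) ≡ 0
  sum-map-zero []       = refl
  sum-map-zero (y ∷ ys) = sum-map-zero ys
sum-map-swap f (x ∷ xs) ys =
  trans (cong (sum (map (f x) ys) +_) (sum-map-swap f xs ys))
        (sym (sum-map-+ _ _ ys))

count-++ : ∀ (p : A → Bool) xs ys → count p (xs ++ ys) ≡ count p xs + count p ys
count-++ p []       ys = refl
count-++ p (x ∷ xs) ys with p x
... | true  = cong suc (count-++ p xs ys)
... | false = count-++ p xs ys

count≡sum : ∀ (p : A → Bool) xs → count p xs ≡ sum (map (λ x → ind (p x)) xs)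
count≡sum p []       = refl
count≡sum p (x ∷ xs) with p x
... | true  = cong suc (count≡sum p xs)
... | false = count≡sum p xs

count-mono : ∀ (p q : A → Bool) xs → (∀ x → p x ≡ true → q x ≡ true) → count p xs ≤ count q xs
count-mono p q []       h = z≤n
count-mono p q (x ∷ xs) h with p x in px | q x in qx
... | true  | true  = s≤s (count-mono p q xs h)
... | false | true  = m≤n⇒m≤1+n (count-mono p q xs h)
... | false | false = count-mono p q xs h
... | true  | false with trans (sym (h x px)) qx
...   | ()

count-≤-+ : ∀ (p q₁ q₂ : A → Bool) xs → (∀ x → ind (p x) ≤ ind (q₁ x) + ind (q₂ x)) →
  count p xs ≤ count q₁ xs + count q₂ xs
count-≤-+ p q₁ q₂ xs h = begin
  count p xs                                              ≡⟨ count≡sum p xs ⟩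
  sum (map (λ x → ind (p x)) xs)                          ≤⟨ sum-map-mono _ _ xs h ⟩
  sum (map (λ x → ind (q₁ x) + ind (q₂ x)) xs)            ≡⟨ sum-map-+ _ _ xs ⟩
  sum (map (λ x → ind (q₁ x)) xs) + sum (map (λ x → ind (q₂ x)) xs)
                                        ≡⟨ cong₂ _+_ (count≡sum q₁ xs) (count≡sum q₂ xs) ⟨
  count q₁ xs + count q₂ xs                               ∎
  where open ≤-Reasoning

count-filter : ∀ (p q : A → Bool) xs →
  count p (filter (λ x → T? (q x)) xs) ≡ count (λ x → q x ∧ p x) xs
count-filter p q []       = refl
count-filter p q (x ∷ xs) with q x
... | false = count-filter p q xs
... | true with p x
...   | true  = cong suc (count-filter p q xs)
...   | false = count-filter p q xs

any-intro : ∀ (p : A → Bool) {x} xs → x ∈ xs → p x ≡ true → any p xs ≡ true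
any-intro p (y ∷ xs) (here refl) e = ∨-trueˡ e
any-intro p (y ∷ xs) (there x∈)  e = ∨-trueʳ (p y) (any-intro p xs x∈ e)

any-elim : ∀ (p : A → Bool) xs → any p xs ≡ true → ∃ λ x → x ∈ xs × p x ≡ true
any-elim p (y ∷ xs) e with p y in py
... | true  = y , here refl , py
... | false with any-elim p xs e
...   | x , x∈ , px = x , there x∈ , px

any⇒1≤count : ∀ (p : A → Bool) xs → any p xs ≡ true → 1 ≤ count p xs
any⇒1≤count p (x ∷ xs) e with p x
... | true  = s≤s z≤n
... | false = any⇒1≤count p xs e

count-map : ∀ (p : B → Bool) (f : A → B) xs →
  count p (map f xs) ≡ count (λ x → p (f x)) xs
count-map p f []       = refl
count-map p f (x ∷ xs) with p (f x)
... | true  = cong suc (count-map p f xs)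
... | false = count-map p f xs

count-concatMap : ∀ (p : B → Bool) (f : A → List B) xs →
  count p (concatMap f xs) ≡ sum (map (λ x → count p (f x)) xs)
count-concatMap p f []       = refl
count-concatMap p f (x ∷ xs) =
  trans (count-++ p (f x) (concatMap f xs)) (cong (count p (f x) +_) (count-concatMap p f xs))

count-allPairs : ∀ {n} (p : Fin n × Fin n → Bool) →
  count p (allPairs n) ≡ sum (map (λ x → count (λ y → p (x , y)) (allFin n)) (allFin n))
count-allPairs {n} p =
  trans (count-concatMap p (λ x → map (x ,_) (allFin n)) (allFin n))
        (cong sum (map-cong (λ x → count-map p (x ,_) (allFin n)) (allFin n)))

Observed : (G : FinGraph) (k : ℕ) → Subset G → V G → Set
Observed G k S v = ∃ λ ℓ → pdIter G k S ℓ v ≡ true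

module _ (G : FinGraph) (k : ℕ) where

  pstep-inflationary : ∀ (P : Subset G) {v} → P v ≡ true → pstep G k P v ≡ true
  pstep-inflationary P e = ∨-trueˡ e

  closedNbhd-self : ∀ (S : Subset G) {v} → S v ≡ true → closedNbhd G S v ≡ true
  closedNbhd-self S e = ∨-trueˡ e

  closedNbhd-adj : ∀ (S : Subset G) {u v} → u ∈ verts G → S u ≡ true → adj G u v ≡ true →
    closedNbhd G S v ≡ true
  closedNbhd-adj S {u} {v} u∈ Su uv =
    ∨-trueʳ (S v) (any-intro (λ u → S u ∧ adj G u v) (verts G) u∈ (cong₂ _∧_ Su uv))

  -- A vertex with no unobserved neighbour need not force: its neighbours are already in P.
  pstep-forces : ∀ (P : Subset G) {v w} → v ∈ verts G → w ∈ verts G →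
    P v ≡ true → adj G v w ≡ true → outside G P v ≤ k → pstep G k P w ≡ true
  pstep-forces P {v} {w} v∈ w∈ Pv vw out≤k with 1 ≤? outside G P v
  ... | yes 1≤out = ∨-trueʳ (P w) (any-intro _ (verts G) v∈
        (cong₂ _∧_ Pv (cong₂ _∧_ vw (cong₂ _∧_ (to T-≡ (≤⇒≤ᵇ 1≤out)) (to T-≡ (≤⇒≤ᵇ out≤k))))))
  ... | no  out≱1 with P w in Pw
  ...   | true  = refl
  ...   | false = ⊥-elim (out≱1 (any⇒1≤count _ (verts G)
                    (any-intro _ (verts G) w∈ (cong₂ (λ b c → b ∧ not c) vw Pw))))

  module _ (S : Subset G) where

    pdIter-mono : ∀ {ℓ L} v → ℓ ≤ L → pdIter G k S ℓ v ≡ true → pdIter G k S L v ≡ true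
    pdIter-mono v ℓ≤L = go (≤⇒≤′ ℓ≤L)
      where
      go : ∀ {ℓ L} → ℓ ≤′ L → pdIter G k S ℓ v ≡ true → pdIter G k S L v ≡ true
      go ≤′-refl             e = e
      go (≤′-step {L′} ℓ≤′L) e = pstep-inflationary (pdIter G k S L′) (go ℓ≤′L e)

    observed-simultaneously : ∀ xs → (∀ v → v ∈ xs → Observed G k S v) →
      ∃ λ L → ∀ v → v ∈ xs → pdIter G k S L v ≡ true
    observed-simultaneously []       h = 0 , λ _ ()
    observed-simultaneously (z ∷ zs) h
      with h z (here refl) | observed-simultaneously zs (λ v v∈ → h v (there v∈))
    ... | ℓ , ez | L , ezs = ℓ ⊔ L , λ where
      v (here refl) → pdIter-mono v (m≤m⊔n ℓ L) ez
      v (there v∈)  → pdIter-mono v (m≤n⊔m ℓ L) (ezs v v∈)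

pendantEdge : ∀ {n} → (Fin n → Fin n → Bool) → (Fin n → Bool) → Fin n × Fin n → Bool
pendantEdge a X (x , y) = X x ∧ not (X y) ∧ a x y

module Hat (n : ℕ) (a : Fin n → Fin n → Bool) (X : Fin n → Bool) where

  X̂ : FinGraph
  X̂ = hat n a X

  inj₁∈⁺ : ∀ {x} → X x ≡ true → inj₁ x ∈ verts X̂
  inj₁∈⁺ {x} Xx = ∈-++⁺ˡ (∈-map⁺ inj₁ (∈-filter⁺ (λ x → T? (X x)) (∈-allFin x) (from T-≡ Xx)))

  inj₁∈⁻ : ∀ {x} → inj₁ x ∈ verts X̂ → X x ≡ true
  inj₁∈⁻ x∈ with ∈-++⁻ (map inj₁ (filter (λ x → T? (X x)) (allFin n))) x∈
  ... | inj₁ x∈₁ with ∈-map⁻ inj₁ x∈₁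
  ...   | _ , x∈₂ , refl = to T-≡ (proj₂ (∈-filter⁻ (λ x → T? (X x)) {xs = allFin n} x∈₂))
  inj₁∈⁻ x∈ | inj₂ x∈₁ with ∈-map⁻ inj₂ x∈₁
  ...   | _ , _ , ()

  inj₂∈⁺ : ∀ {x y} → pendantEdge a X (x , y) ≡ true → inj₂ (x , y) ∈ verts X̂
  inj₂∈⁺ {x} {y} e = ∈-++⁺ʳ (map inj₁ (filter (λ x → T? (X x)) (allFin n)))
    (∈-map⁺ inj₂ (∈-filter⁺ (λ p → T? (pendantEdge a X p)) xy∈ (from T-≡ e)))
    where
    xy∈ : (x , y) ∈ allPairs n
    xy∈ = ∈-concatMap⁺ (λ x → map (x ,_) (allFin n))
            (Any.map (λ { refl → ∈-map⁺ (x ,_) (∈-allFin y) }) (∈-allFin x))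

  inj₂∈⁻ : ∀ {x y} → inj₂ (x , y) ∈ verts X̂ → pendantEdge a X (x , y) ≡ true
  inj₂∈⁻ p∈ with ∈-++⁻ (map inj₁ (filter (λ x → T? (X x)) (allFin n))) p∈
  ... | inj₁ p∈₁ with ∈-map⁻ inj₁ p∈₁
  ...   | _ , _ , ()
  inj₂∈⁻ p∈ | inj₂ p∈₁ with ∈-map⁻ inj₂ p∈₁
  ...   | _ , p∈₂ , refl =
    to T-≡ (proj₂ (∈-filter⁻ (λ p → T? (pendantEdge a X p)) {xs = allPairs n} p∈₂))

  count-verts : ∀ (q : Subset X̂) → count q (verts X̂) ≡
    count (λ x → X x ∧ q (inj₁ x)) (allFin n) +
    sum (map (λ x → count (λ y → pendantEdge a X (x , y) ∧ q (inj₂ (x , y))) (allFin n)) (allFin n))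
  count-verts q = begin
    count q (verts X̂)
      ≡⟨ count-++ q (map inj₁ (filter (λ x → T? (X x)) (allFin n))) _ ⟩
    count q (map inj₁ (filter (λ x → T? (X x)) (allFin n))) +
    count q (map inj₂ (filter (λ p → T? (pendantEdge a X p)) (allPairs n)))
      ≡⟨ cong₂ _+_ (count-map q inj₁ (filter (λ x → T? (X x)) (allFin n)))
                   (count-map q inj₂ (filter (λ p → T? (pendantEdge a X p)) (allPairs n))) ⟩
    count (λ x → q (inj₁ x)) (filter (λ x → T? (X x)) (allFin n)) +
    count (λ p → q (inj₂ p)) (filter (λ p → T? (pendantEdge a X p)) (allPairs n))
      ≡⟨ cong₂ _+_ (count-filter _ X (allFin n)) (count-filter _ (pendantEdge a X) (allPairs n)) ⟩
    count (λ x → X x ∧ q (inj₁ x)) (allFin n) +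
    count (λ p → pendantEdge a X p ∧ q (inj₂ p)) (allPairs n)
      ≡⟨ cong (count (λ x → X x ∧ q (inj₁ x)) (allFin n) +_)
           (count-allPairs (λ p → pendantEdge a X p ∧ q (inj₂ p))) ⟩
    count (λ x → X x ∧ q (inj₁ x)) (allFin n) +
    sum (map (λ x → count (λ y → pendantEdge a X (x , y) ∧ q (inj₂ (x , y))) (allFin n)) (allFin n))
      ∎
    where open ≡-Reasoning

  -- The neighbour u of x seen from x ∈ X inside X̂: u itself, or the pendent vertex standing for it.
  shadow : Fin n → Fin n → Fin n ⊎ (Fin n × Fin n)
  shadow x u = if X u then inj₁ u else inj₂ (x , u)

  shadow∈ : ∀ {x u} → X x ≡ true → a x u ≡ true → shadow x u ∈ verts X̂
  shadow∈ {x} {u} Xx xu with X u in Xu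
  ... | true  = inj₁∈⁺ Xu
  ... | false = inj₂∈⁺ (trans (cong₂ (λ b c → b ∧ not c ∧ a x u) Xx Xu) xu)

  outside-shadow : ∀ (P : Subset X̂) {x} → X x ≡ true →
    count (λ u → a x u ∧ not (P (shadow x u))) (allFin n) ≤ outside X̂ P (inj₁ x)
  outside-shadow P {x} Xx = begin
    count (λ u → a x u ∧ not (P (shadow x u))) (allFin n)
      ≤⟨ count-≤-+ _ inner pendent (allFin n) split ⟩
    count inner (allFin n) + count pendent (allFin n)
      ≤⟨ +-monoʳ-≤ (count inner (allFin n))
           (sum-map-∈ (λ x' → count (q' x') (allFin n)) (allFin n) (∈-allFin x)) ⟩
    count inner (allFin n) + sum (map (λ x' → count (q' x') (allFin n)) (allFin n))
      ≡⟨ count-verts q ⟨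
    outside X̂ P (inj₁ x)
      ∎
    where
    open ≤-Reasoning
    q : Subset X̂
    q w = hatAdj a (inj₁ x) w ∧ not (P w)
    inner pendent : Fin n → Bool
    inner u = X u ∧ q (inj₁ u)
    q' : Fin n → Fin n → Bool
    q' x' y = pendantEdge a X (x' , y) ∧ q (inj₂ (x' , y))
    pendent = q' x
    split : ∀ u → ind (a x u ∧ not (P (shadow x u))) ≤ ind (inner u) + ind (pendent u)
    split u rewrite Xx | ==-refl x with X u
    ... | true  = m≤m+n _ _
    ... | false = ≤-refl

module Merge (k n r : ℕ) (a : Fin n → Fin n → Bool) (part : Fin n → Fin r)
             (Ss : (i : Fin r) → Subset (hat n a (λ v → part v == i))) where

  G : FinGraph
  G = toGraph n a

  block : Fin r → Fin n → Bool
  block i v = part v == i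

  module H (i : Fin r) = Hat n a (block i)
  open H using (X̂; inj₁∈⁺; inj₁∈⁻; inj₂∈⁻; shadow; shadow∈; outside-shadow; count-verts)

  block-part : ∀ {i x} → part x ≡ i → block i x ≡ true
  block-part {x = x} refl = ==-refl (part x)

  pendantEdge-part : ∀ {i x y} → pendantEdge a (block i) (x , y) ≡ true → part x ≡ i × a x y ≡ true
  pendantEdge-part {i} {x} {y} e with block i x in bx | block i y
  ... | true | false = ==⇒≡ bx , e

  merged : Subset G
  merged x = Ss (part x) (inj₁ x)
           ∨ any (λ y → pendantEdge a (block (part x)) (x , y) ∧ Ss (part x) (inj₂ (x , y))) (allFin n)

  Seen : Fin n → Set
  Seen = Observed G k merged

  attachment : Fin n ⊎ (Fin n × Fin n) → Fin n
  attachment (inj₁ x)       = x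
  attachment (inj₂ (x , _)) = x

  -- Besides y, a pendent vertex (x , y) records its attachment x, which must be seen
  -- in G when (x , y) forces x inside P̂_i.
  Accounted : Fin n ⊎ (Fin n × Fin n) → Set
  Accounted (inj₁ x)       = Seen x
  Accounted (inj₂ (x , y)) = Seen x × Seen y

  seen-merged : ∀ {x} → merged x ≡ true → Seen x
  seen-merged e = 0 , closedNbhd-self G k merged e

  seen-merged-adj : ∀ {x y} → merged x ≡ true → a x y ≡ true → Seen y
  seen-merged-adj e xy = 0 , closedNbhd-adj G k merged (∈-allFin _) e xy

  merged-attachment : ∀ i {w} → w ∈ verts (X̂ i) → Ss i w ≡ true → merged (attachment w) ≡ true
  merged-attachment i {inj₁ x} w∈ e with ==⇒≡ (inj₁∈⁻ i w∈)
  ... | refl = ∨-trueˡ e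
  merged-attachment i {inj₂ (x , y)} w∈ e with pendantEdge-part (inj₂∈⁻ i w∈)
  ... | refl , _ = ∨-trueʳ (Ss (part x) (inj₁ x))
        (any-intro _ (allFin n) (∈-allFin y) (cong₂ _∧_ (inj₂∈⁻ (part x) w∈) e))

  accounted-attachment : ∀ i {w} → w ∈ verts (X̂ i) → merged (attachment w) ≡ true → Accounted w
  accounted-attachment i {inj₁ x}       w∈ e = seen-merged e
  accounted-attachment i {inj₂ (x , y)} w∈ e =
    seen-merged e , seen-merged-adj e (proj₂ (pendantEdge-part (inj₂∈⁻ i w∈)))

  accounted-closedNbhd : ∀ i {w} → w ∈ verts (X̂ i) → closedNbhd (X̂ i) (Ss i) w ≡ true → Accounted w
  accounted-closedNbhd i {w} w∈ e with ∨-true⁻ (Ss i w) _ e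
  ... | inj₁ Sw = accounted-attachment i w∈ (merged-attachment i w∈ Sw)
  ... | inj₂ e′ with any-elim (λ u → Ss i u ∧ hatAdj a u w) (verts (X̂ i)) e′
  ...   | u , u∈ , Su∧uw with ∧-true⁻ (Ss i u) _ Su∧uw
  ...     | Su , uw = via u w w∈ uw (merged-attachment i u∈ Su)
    where
    via : ∀ u w → w ∈ verts (X̂ i) → hatAdj a u w ≡ true → merged (attachment u) ≡ true → Accounted w
    via (inj₁ x) (inj₁ y) _ xy m = seen-merged-adj m xy
    via (inj₁ x) (inj₂ (x′ , y)) w∈ xx′ m with ==⇒≡ xx′
    ... | refl = accounted-attachment i w∈ m
    via (inj₂ (x′ , _)) (inj₁ x) _ x′x m with ==⇒≡ x′x
    ... | refl = seen-merged m

  module Forcing (i : Fin r) (ℓ : ℕ)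
    (accounted : ∀ {w} → w ∈ verts (X̂ i) → pdIter (X̂ i) k (Ss i) ℓ w ≡ true → Accounted w) where

    P : Subset (X̂ i)
    P = pdIter (X̂ i) k (Ss i) ℓ

    seen-shadow : ∀ {x u} → part x ≡ i → a x u ≡ true → P (shadow i x u) ≡ true → Seen u
    seen-shadow {x} {u} refl xu Pu with accounted (shadow∈ i (==-refl (part x)) xu) Pu
    ... | acc with block (part x) u
    ...   | true  = acc
    ...   | false = proj₂ acc

    forces-in-G : ∀ {x} → part x ≡ i → P (inj₁ x) ≡ true → outside (X̂ i) P (inj₁ x) ≤ k →
      ∀ {y} → a x y ≡ true → Seen y
    forces-in-G {x} px Px out≤k {y} xy =
      suc L , pstep-forces G k Q (∈-allFin x) (∈-allFin y) (observed-at-L (here refl)) xy out-G≤k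
      where
      observedInX̂ : Fin n → Bool
      observedInX̂ u = a x u ∧ P (shadow i x u)
      watched : List (Fin n)
      watched = x ∷ filter (λ u → T? (observedInX̂ u)) (allFin n)
      seen-watched : ∀ v → v ∈ watched → Seen v
      seen-watched v (here refl) = accounted (inj₁∈⁺ i (block-part px)) Px
      seen-watched v (there v∈)
        with ∧-true⁻ (a x v) _ (to T-≡ (proj₂ (∈-filter⁻ (λ u → T? (observedInX̂ u)) {xs = allFin n} v∈)))
      ... | xv , Pv = seen-shadow px xv Pv
      watched⁺ : ∀ {u} → a x u ≡ true → P (shadow i x u) ≡ true → u ∈ watched
      watched⁺ {u} xu Pu =
        there (∈-filter⁺ (λ u → T? (observedInX̂ u)) (∈-allFin u) (from T-≡ (cong₂ _∧_ xu Pu)))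
      L : ℕ
      L = proj₁ (observed-simultaneously G k merged watched seen-watched)
      observed-at-L : ∀ {v} → v ∈ watched → pdIter G k merged L v ≡ true
      observed-at-L v∈ = proj₂ (observed-simultaneously G k merged watched seen-watched) _ v∈
      Q : Subset G
      Q = pdIter G k merged L
      out-G≤k : outside G Q x ≤ k
      out-G≤k = begin
        outside G Q x
          ≤⟨ count-mono _ _ (allFin n) (λ u → ∧-not-antitone (a x u) (Q u) (P (shadow i x u))
               (λ xu Pu → observed-at-L (watched⁺ xu Pu))) ⟩
        count (λ u → a x u ∧ not (P (shadow i x u))) (allFin n)
          ≤⟨ outside-shadow i P (block-part px) ⟩
        outside (X̂ i) P (inj₁ x)
          ≤⟨ out≤k ⟩
        k ∎
        where open ≤-Reasoning

    accounted-forced : ∀ {v w} → v ∈ verts (X̂ i) → w ∈ verts (X̂ i) →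
      (P v ∧ hatAdj a v w ∧ (1 ≤ᵇ outside (X̂ i) P v) ∧ (outside (X̂ i) P v ≤ᵇ k)) ≡ true → Accounted w
    accounted-forced {v} {w} v∈ w∈ forcing with ∧-true⁻ (P v) _ forcing
    ... | Pv , rest with ∧-true⁻ (hatAdj a v w) _ rest
    ... | vw , rest′ = go v w v∈ w∈ Pv vw (≤ᵇ⇒≤ _ _ (from T-≡ (proj₂ (∧-true⁻ _ _ rest′))))
      where
      go : ∀ v w → v ∈ verts (X̂ i) → w ∈ verts (X̂ i) → P v ≡ true → hatAdj a v w ≡ true →
        outside (X̂ i) P v ≤ k → Accounted w
      go (inj₁ x) (inj₁ y) v∈ _ Pv xy out≤k = forces-in-G (==⇒≡ (inj₁∈⁻ i v∈)) Pv out≤k xy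
      go (inj₁ x) (inj₂ (x′ , y)) v∈ w∈ Pv xx′ out≤k with ==⇒≡ xx′
      ... | refl = accounted v∈ Pv
                 , forces-in-G (==⇒≡ (inj₁∈⁻ i v∈)) Pv out≤k (proj₂ (pendantEdge-part (inj₂∈⁻ i w∈)))
      go (inj₂ (x′ , _)) (inj₁ x) v∈ _ Pv x′x _ with ==⇒≡ x′x
      ... | refl = proj₁ (accounted v∈ Pv)

  accounted-pdIter : ∀ i ℓ {w} → w ∈ verts (X̂ i) → pdIter (X̂ i) k (Ss i) ℓ w ≡ true → Accounted w
  accounted-pdIter i zero    w∈ e = accounted-closedNbhd i w∈ e
  accounted-pdIter i (suc ℓ) {w} w∈ e with ∨-true⁻ (pdIter (X̂ i) k (Ss i) ℓ w) _ e
  ... | inj₁ e′ = accounted-pdIter i ℓ w∈ e′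
  ... | inj₂ e′ with any-elim _ (verts (X̂ i)) e′
  ...   | v , v∈ , forcing = Forcing.accounted-forced i ℓ (accounted-pdIter i ℓ) v∈ w∈ forcing

  merged-dominates : (∀ i → IsKPowerDom (X̂ i) k (Ss i)) → IsKPowerDom G k merged
  merged-dominates dom = observed-simultaneously G k merged (allFin n) seen
    where
    seen : ∀ v → v ∈ allFin n → Seen v
    seen v _ with dom (part v)
    ... | ℓ , complete = accounted-pdIter (part v) ℓ v∈ (complete (inj₁ v) v∈)
      where
      v∈ = inj₁∈⁺ (part v) (==-refl (part v))

  attachedSize : Fin r → Fin n → ℕ
  attachedSize i x = ind (block i x ∧ Ss i (inj₁ x))
               + count (λ y → pendantEdge a (block i) (x , y) ∧ Ss i (inj₂ (x , y))) (allFin n)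

  size-X̂ : ∀ i → size (X̂ i) (Ss i) ≡ sum (map (attachedSize i) (allFin n))
  size-X̂ i = begin
    size (X̂ i) (Ss i)
      ≡⟨ count-verts i (Ss i) ⟩
    count own (allFin n) + sum (map pendants (allFin n))
      ≡⟨ cong (_+ sum (map pendants (allFin n))) (count≡sum own (allFin n)) ⟩
    sum (map (λ x → ind (own x)) (allFin n)) + sum (map pendants (allFin n))
      ≡⟨ sum-map-+ (λ x → ind (own x)) pendants (allFin n) ⟨
    sum (map (attachedSize i) (allFin n))
      ∎
    where
    open ≡-Reasoning
    own : Fin n → Bool
    own x = block i x ∧ Ss i (inj₁ x)
    pendants : Fin n → ℕ
    pendants x = count (λ y → pendantEdge a (block i) (x , y) ∧ Ss i (inj₂ (x , y))) (allFin n)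

  merged≤attachedSize : ∀ x → ind (merged x) ≤ attachedSize (part x) x
  merged≤attachedSize x =
    subst (λ b → ind (merged x) ≤ ind (b ∧ Ss (part x) (inj₁ x)) + count pendant (allFin n))
      (sym (==-refl (part x)))
      (ind-∨≤ (Ss (part x) (inj₁ x)) (any pendant (allFin n)) (any⇒1≤count pendant (allFin n)))
    where
    pendant : Fin n → Bool
    pendant y = pendantEdge a (block (part x)) (x , y) ∧ Ss (part x) (inj₂ (x , y))

  size-merged : size G merged ≤ sum (map (λ i → size (X̂ i) (Ss i)) (allFin r))
  size-merged = begin
    count merged (allFin n)
      ≡⟨ count≡sum merged (allFin n) ⟩
    sum (map (λ x → ind (merged x)) (allFin n))
      ≤⟨ sum-map-mono _ _ (allFin n) (λ x →
           ≤-trans (merged≤attachedSize x) (sum-map-∈ (λ i → attachedSize i x) (allFin r) (∈-allFin (part x)))) ⟩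
    sum (map (λ x → sum (map (λ i → attachedSize i x) (allFin r))) (allFin n))
      ≡⟨ sum-map-swap attachedSize (allFin r) (allFin n) ⟨
    sum (map (λ i → sum (map (attachedSize i) (allFin n))) (allFin r))
      ≡⟨ cong sum (map-cong (λ i → size-X̂ i) (allFin r)) ⟨
    sum (map (λ i → size (X̂ i) (Ss i)) (allFin r))
      ∎
    where open ≤-Reasoning

theorem4p9 : (k n r : ℕ) (a : Fin n → Fin n → Bool)
    → Symmetric a → Irreflexive a → Connected a
    → (part : Fin n → Fin r)
    → (∀ i → ∃ λ v → part v ≡ i)
    → (m : ℕ) (ms : Fin r → ℕ)
    → IsPowerDomNumber (toGraph n a) k m
    → (∀ i → IsPowerDomNumber (hat n a (λ v → part v == i)) k (ms i))
    → m ≤ sumFin r ms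
theorem4p9 k n r a _ _ _ part _ m ms (_ , minimal) optimal = begin
  m                                                ≤⟨ minimal merged (merged-dominates dominating) ⟩
  size G merged                                    ≤⟨ size-merged ⟩
  sum (map (λ i → size (H.X̂ i) (Ss i)) (allFin r)) ≡⟨ cong sum (map-cong sizes (allFin r)) ⟩
  sum (map ms (allFin r))                          ≡⟨ cong sum (map-tabulate (λ i → i) ms) ⟩
  sumFin r ms                                      ∎
  where
  Ss : (i : Fin r) → Subset (hat n a (λ v → part v == i))
  Ss i = proj₁ (proj₁ (optimal i))
  dominating : ∀ i → IsKPowerDom (hat n a (λ v → part v == i)) k (Ss i)
  dominating i = proj₁ (proj₂ (proj₁ (optimal i)))
  sizes : ∀ i → size (hat n a (λ v → part v == i)) (Ss i) ≡ ms i
  sizes i = proj₂ (proj₂ (proj₁ (optimal i)))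
  open Merge k n r a part Ss
  open ≤-Reasoning
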